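{- Let $G$ be a self-contained graph and $P, Q \in \mathrm{Rem}(G)$ with $V(P)\cap V(Q) = \emptyset$. Then $P \cup Q \in \mathrm{Rem}(G)$ if and only if there exists an isomorphism $f: G \to G\setminus P$ such that $f^{ -1}(Q) \in \mathrm{Rem}(G)$. In particular, if there is an isomorphism $f: G\to G\setminus P$ such that $f(Q) = Q$, then $P\cup Q \in \mathrm{Rem}(G)$.
   Context: All graphs are simple. A self-contained graph is an infinite graph which is isomorphic to one of its proper induced subgraphs. For an induced subgraph $H$ of $G$, $G \setminus H$ denotes $G[V(G)\setminus V(H)]$. For a self-contained graph $G$, a removable subgraph of $G$ is a proper induced subgraph $H$ of $G$ with $V(H)\neq\emptyset$ such that $G\setminus H \cong G$; $\mathrm{Rem}(G)$ is the set of removable subgraphs. $P\cup Q$ denotes the induced subgraph $G[V(P)\cup V(Q)]$; for an isomorphism $f:G\to G\setminus P$, $f^{ -1}(Q)$ is the induced subgraph of $G$ on $f^{ -1}(V(Q))$ and $f(Q)$ is the induced subgraph on $f(V(Q))$. -}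

module Defs where

open import Data.Nat using (ℕ)
open import Data.Fin using (Fin)
open import Data.Unit using (⊤; tt)
open import Data.Empty using (⊥)
open import Data.Sum using (_⊎_)
open import Data.Product using (Σ; ∃; ∃-syntax; Σ-syntax; _×_; _,_; proj₁; proj₂)
open import Relation.Nullary using (¬_)
open import Relation.Binary.PropositionalEquality using (_≡_)
open import Function.Bundles using (_↔_; _⇔_)

record Graph : Set₁ where
  field
    V      : Set
    Adj    : V → V → Set
    sym    : ∀ {x y} → Adj x y → Adj y x
    irrefl : ∀ {x} → ¬ Adj x x

module _ (G : Graph) where
  open Graph G

  -- An induced subgraph of G is given by its vertex set (a predicate on V).
  Sub : Set₁
  Sub = V → Set

  Whole : Sub
  Whole _ = ⊤

  ∁ : Sub → Sub
  ∁ H v = ¬ H v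

  _∪_ : Sub → Sub → Sub
  (P ∪ Q) v = P v ⊎ Q v

  Disjoint : Sub → Sub → Set
  Disjoint P Q = ∀ v → P v → Q v → ⊥

  Nonempty : Sub → Set
  Nonempty H = ∃[ v ] H v

  Proper : Sub → Set
  Proper H = ∃[ v ] ¬ H v

  -- Graph isomorphism G[S] → G[T]; vertices are compared by their
  -- underlying vertex of G (so membership proofs are irrelevant).
  record _≅_ (S T : Sub) : Set where
    field
      to   : Σ V S → Σ V T
      resp : (x y : Σ V S) → proj₁ x ≡ proj₁ y → proj₁ (to x) ≡ proj₁ (to y)
      inj  : (x y : Σ V S) → proj₁ (to x) ≡ proj₁ (to y) → proj₁ x ≡ proj₁ y
      surj : (y : Σ V T) → Σ[ x ∈ Σ V S ] proj₁ (to x) ≡ proj₁ y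
      adj  : (x y : Σ V S) → Adj (proj₁ x) (proj₁ y) ⇔ Adj (proj₁ (to x)) (proj₁ (to y))

  Infinite : Set
  Infinite = ¬ (∃[ n ] (Fin n ↔ V))

  SelfContained : Set₁
  SelfContained = Infinite × (∃[ S ] (Proper S × (Whole ≅ S)))

  Rem : Sub → Set
  Rem H = Nonempty H × Proper H × (∁ H ≅ Whole)

  app : {S : Sub} → Whole ≅ S → V → V
  app f v = proj₁ (_≅_.to f (v , tt))

  preimage : {S : Sub} → Whole ≅ S → Sub → Sub
  preimage f Q v = Q (app f v)

  image : {S : Sub} → Whole ≅ S → Sub → Sub
  image f Q w = ∃[ v ] (Q v × app f v ≡ w)

  SameSet : Sub → Sub → Set
  SameSet A B = ∀ v → A v ⇔ B v

-- The whole argument rests on one observation (restrict-to-complement):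
-- an isomorphism f : G ≅ G ∖ P restricts to an isomorphism
--   G ∖ f⁻¹(Q) ≅ (G ∖ P) ∖ Q = G ∖ (P ∪ Q).
-- Hence G ∖ f⁻¹(Q) ≅ G iff G ∖ (P ∪ Q) ≅ G, using that isomorphisms of
-- induced subgraphs compose and invert.  The remaining conditions of
-- removability (nonempty, proper) are transferred along f separately.
-- For the second part, f(Q) = Q forces f⁻¹(Q) = Q because f is injective,
-- and removability only depends on the vertex set.
module Submission where

open import Defs
open import Data.Product using (Σ; Σ-syntax; _×_; _,_; proj₁; proj₂)
open import Data.Sum using (inj₁; inj₂)
open import Data.Unit using (tt)
open import Function.Bundles using (_⇔_; mk⇔; Equivalence)
open import Relation.Nullary using (¬_)
open import Relation.Binary.PropositionalEquality using (_≡_; refl; sym; trans; subst; subst₂)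

module Removability (G : Graph) where
  open Graph G using (V; Adj)
  open _≅_

  _∘≅_ : {S T U : Sub G} → _≅_ G T U → _≅_ G S T → _≅_ G S U
  g ∘≅ f = record
    { to   = λ x → to g (to f x)
    ; resp = λ x y e → resp g _ _ (resp f x y e)
    ; inj  = λ x y e → inj f x y (inj g _ _ e)
    ; surj = λ z → let (y , e) = surj g z ; (x , e′) = surj f y
                   in x , trans (resp g _ _ e′) e
    ; adj  = λ x y → mk⇔
        (λ a → Equivalence.to (adj g _ _) (Equivalence.to (adj f x y) a))
        (λ a → Equivalence.from (adj f x y) (Equivalence.from (adj g _ _) a))
    }

  ≅-sym : {S T : Sub G} → _≅_ G S T → _≅_ G T S
  ≅-sym f = record
    { to   = λ y → proj₁ (surj f y)
    ; resp = λ x y e → inj f _ _ (trans (section x) (trans e (sym (section y))))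
    ; inj  = λ x y e → trans (sym (section x)) (trans (resp f _ _ e) (section y))
    ; surj = λ x → to f x , inj f _ _ (section (to f x))
    ; adj  = λ x y →
        let a = adj f (proj₁ (surj f x)) (proj₁ (surj f y)) in
        mk⇔ (λ h → Equivalence.from a (subst₂ Adj (sym (section x)) (sym (section y)) h))
            (λ h → subst₂ Adj (section x) (section y) (Equivalence.to a h))
    }
    where
      section : (y : Σ V _) → proj₁ (to f (proj₁ (surj f y))) ≡ proj₁ y
      section y = proj₂ (surj f y)

  SameSet⇒≅ : {S T : Sub G} → SameSet G S T → _≅_ G S T
  SameSet⇒≅ S≡T = record
    { to   = λ { (v , s) → v , Equivalence.to (S≡T v) s }
    ; resp = λ x y e → e
    ; inj  = λ x y e → e
    ; surj = λ { (v , t) → (v , Equivalence.from (S≡T v) t) , refl }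
    ; adj  = λ x y → mk⇔ (λ h → h) (λ h → h)
    }

  Rem-resp-SameSet : {A B : Sub G} → SameSet G A B → Rem G A → Rem G B
  Rem-resp-SameSet {A} {B} A≡B ((v , Av) , (w , ¬Aw) , G∖A≅G) =
      (v , Equivalence.to (A≡B v) Av)
    , (w , λ Bw → ¬Aw (Equivalence.from (A≡B w) Bw))
    , G∖A≅G ∘≅ SameSet⇒≅ complement
    where
      complement : SameSet G (∁ G B) (∁ G A)
      complement u = mk⇔ (λ ¬Bu Au → ¬Bu (Equivalence.to (A≡B u) Au))
                         (λ ¬Au Bu → ¬Au (Equivalence.from (A≡B u) Bu))

  module _ (P Q : Sub G) (f : _≅_ G (Whole G) (∁ G P)) where

    Q′ : Sub G
    Q′ = preimage G {∁ G P} f Q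

    f-avoids-P : ∀ v → ¬ P (app G f v)
    f-avoids-P v = proj₂ (_≅_.to f (v , tt))

    restrict-to-complement : _≅_ G (∁ G Q′) (∁ G (_∪_ G P Q))
    restrict-to-complement = record
      { to   = λ { (v , ¬Q′v) → app G f v
                 , λ { (inj₁ p) → f-avoids-P v p ; (inj₂ q) → ¬Q′v q } }
      ; resp = λ { (v , _) (w , _) → resp f (v , tt) (w , tt) }
      ; inj  = λ { (v , _) (w , _) → inj f (v , tt) (w , tt) }
      ; surj = λ { (w , ¬PQw) →
                   let ((x , _) , e) = surj f (w , λ p → ¬PQw (inj₁ p)) in
                   (x , λ q → ¬PQw (inj₂ (subst Q e q))) , e }
      ; adj  = λ { (v , _) (w , _) → adj f (v , tt) (w , tt) }
      }

    -- Every vertex outside P has an f-preimage; so f⁻¹(Q) is nonempty when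
    -- Q has a vertex outside P ...
    preimage-nonempty : Disjoint G P Q → Nonempty G Q → Nonempty G Q′
    preimage-nonempty disj (q , Qq) =
      let (x , e) = surj f (q , λ Pq → disj q Pq Qq) in
      proj₁ x , subst Q (sym e) Qq

    preimage-proper : Proper G (_∪_ G P Q) → Proper G Q′
    preimage-proper (w , ¬PQw) =
      let (x , e) = surj f (w , λ p → ¬PQw (inj₁ p)) in
      proj₁ x , λ q → ¬PQw (inj₂ (subst Q e q))

    union-proper : Proper G Q′ → Proper G (_∪_ G P Q)
    union-proper (v , ¬Q′v) =
      app G f v , λ { (inj₁ p) → f-avoids-P v p ; (inj₂ q) → ¬Q′v q }

    -- If f(Q) = Q then f⁻¹(Q) = Q, by injectivity of f.
    invariant⇒preimage-same : SameSet G (image G {∁ G P} f Q) Q → SameSet G Q Q′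
    invariant⇒preimage-same fQ≡Q v = mk⇔ forward backward
      where
        backward : Q (app G f v) → Q v
        backward Qfv =
          let (u , Qu , e) = Equivalence.from (fQ≡Q (app G f v)) Qfv in
          subst Q (inj f (u , tt) (v , tt) e) Qu
        forward : Q v → Q (app G f v)
        forward Qv = Equivalence.to (fQ≡Q (app G f v)) (v , Qv , refl)

  -- (⇒) Take f to be the inverse of a witness G ∖ P ≅ G.
  rem-union⇒rem-preimage : (P Q : Sub G) → Rem G P → Nonempty G Q → Disjoint G P Q →
    Rem G (_∪_ G P Q) → Σ[ f ∈ _≅_ G (Whole G) (∁ G P) ] Rem G (preimage G {∁ G P} f Q)
  rem-union⇒rem-preimage P Q (_ , _ , G∖P≅G) neQ disj (_ , properPQ , G∖PQ≅G) =
      f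
    , preimage-nonempty P Q f disj neQ
    , preimage-proper P Q f properPQ
    , G∖PQ≅G ∘≅ restrict-to-complement P Q f
    where
      f : _≅_ G (Whole G) (∁ G P)
      f = ≅-sym G∖P≅G

  -- (⇐) P ∪ Q contains the nonempty P, and G ∖ (P ∪ Q) ≅ G ∖ f⁻¹(Q) ≅ G.
  rem-preimage⇒rem-union : (P Q : Sub G) → Nonempty G P →
    (Σ[ f ∈ _≅_ G (Whole G) (∁ G P) ] Rem G (preimage G {∁ G P} f Q)) → Rem G (_∪_ G P Q)
  rem-preimage⇒rem-union P Q (p , Pp) (f , _ , properQ′ , G∖Q′≅G) =
      (p , inj₁ Pp)
    , union-proper P Q f properQ′
    , G∖Q′≅G ∘≅ ≅-sym (restrict-to-complement P Q f)

proposition3p8 : (G : Graph) → SelfContained G →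
    (P Q : Sub G) → Rem G P → Rem G Q → Disjoint G P Q →
    (Rem G (_∪_ G P Q) ⇔ (Σ[ f ∈ _≅_ G (Whole G) (∁ G P) ] Rem G (preimage G {∁ G P} f Q)))
    × ((Σ[ f ∈ _≅_ G (Whole G) (∁ G P) ] SameSet G (image G {∁ G P} f Q) Q) → Rem G (_∪_ G P Q))
proposition3p8 G _ P Q remP remQ disj = characterisation , invariant-case
  where
    open Removability G

    characterisation : Rem G (_∪_ G P Q) ⇔ (Σ[ f ∈ _≅_ G (Whole G) (∁ G P) ] Rem G (preimage G {∁ G P} f Q))
    characterisation = mk⇔ (rem-union⇒rem-preimage P Q remP (proj₁ remQ) disj)
                           (rem-preimage⇒rem-union P Q (proj₁ remP))

    -- f(Q) = Q gives f⁻¹(Q) = Q, which is removable by hypothesis.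
    invariant-case : (Σ[ f ∈ _≅_ G (Whole G) (∁ G P) ] SameSet G (image G {∁ G P} f Q) Q) → Rem G (_∪_ G P Q)
    invariant-case (f , fQ≡Q) =
      rem-preimage⇒rem-union P Q (proj₁ remP)
        (f , Rem-resp-SameSet (invariant⇒preimage-same P Q f fQ≡Q) remQ)
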